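{- Let $F$ be a tree with no vertex of degree $2$, rooted at a leaf $r$, and let $C$ be a conflict-free edge-coloring of $F$ with colors red and blue in which red is a conflict-free color of every edge of $F$. Let $v\neq r$ be a vertex with $v^+\neq r$... more precisely, let $v$ be a non-root vertex such that $T=Sub_F(v)$ is a full tree, with levels $0,1,\dots,m$. Then for each $i$ with $1\le i\le m-1$, the vertices of the $i$-th level $L_i(T)$ are either all S-vertices or all D-vertices (with respect to $C$).
   Context: Edges of $F$ are oriented away from the root $r$ (so $F$ is an out-branching); for a non-root vertex $x$, $x^+$ denotes its father, and the sons of $x$ are its out-neighbours. An inner vertex is a vertex with at least one son. For an edge-coloring, a color is a conflict-free color of an edge $e=xy$ if it is assigned to exactly one edge of $E(x)\cup E(y)$, where $E(x)$ is the set of edges incident with $x$; a coloring is conflict-free if every edge has a conflict-free color. With respect to a red/blue coloring, an inner vertex is an S-vertex if all its out-edges (edges to its sons) are blue, and a D-vertex if some out-edge is red. For a non-root vertex $v$, $Sub_F(v)$ is the subtree induced by $v^+$, $v$ and all descendants of $v$, rooted at $v^+$; the level of a vertex in it is its distance from $v^+$, and $L_i$ denotes the set of vertices at level $i$. $Sub_F(v)$ is a full tree if, for some $m\ge1$, all its vertices other than $v^+$ that have no sons lie at level $m$ and every vertex at levels $1,\dots,m-1$ has at least two sons. -}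

module Defs where

open import Data.Nat using (ℕ; zero; suc; _+_; _≤_; _<_)
open import Data.Fin using (Fin)
open import Data.Fin.Properties using () renaming (_≟_ to _≟ᶠ_)
open import Data.Maybe using (Maybe; just; nothing; maybe)
open import Data.Maybe.Properties using (≡-dec)
open import Data.List using (length; filter; allFin)
open import Data.Product using (∃; _×_; _,_)
open import Data.Sum using (_⊎_)
open import Relation.Nullary using (¬_)
open import Relation.Binary.PropositionalEquality using (_≡_; _≢_)

-- A finite rooted tree (out-branching) on vertex set Fin n, given by the
-- father function x ↦ x⁺.  The depth function witnesses that this is a tree:
-- the root is the only vertex without a father and depth drops by one along
-- each father pointer, so following fathers always ends at the root.
record RootedTree (n : ℕ) : Set where
  field
    father         : Fin n → Maybe (Fin n)
    root           : Fin n
    root-nofather  : father root ≡ nothing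
    nonroot-father : ∀ x → x ≢ root → ∃ λ y → father x ≡ just y
    depth          : Fin n → ℕ
    depth-father   : ∀ x y → father x ≡ just y → depth x ≡ suc (depth y)

data Color : Set where
  red blue : Color

-- Edges of the tree are identified with their lower endpoint: the non-root
-- vertex y stands for the edge y⁺ y.  An edge-colouring is a map
-- c : Fin n → Color whose value at the root is irrelevant (never used).
module _ {n : ℕ} (T : RootedTree n) where
  open RootedTree T

  IsSon : Fin n → Fin n → Set
  IsSon x y = father y ≡ just x

  sonCount : Fin n → ℕ
  sonCount x = length (filter (λ y → ≡-dec _≟ᶠ_ (father y) (just x)) (allFin n))

  degree : Fin n → ℕ
  degree x = sonCount x + maybe (λ _ → 1) 0 (father x)

  Incident : Fin n → Fin n → Set
  Incident x z = IsSon x z ⊎ (z ≡ x × x ≢ root)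

  -- z ∈ E(y⁺) ∪ E(y), for the edge y (= y⁺ y)
  EdgeNbhd : Fin n → Fin n → Set
  EdgeNbhd y z = (∃ λ x → father y ≡ just x × Incident x z) ⊎ Incident y z

  IsCFColor : (Fin n → Color) → Fin n → Color → Set
  IsCFColor c y col =
    ∃ λ z → EdgeNbhd y z × c z ≡ col ×
      (∀ z′ → EdgeNbhd y z′ → c z′ ≡ col → z′ ≡ z)

  ConflictFree : (Fin n → Color) → Set
  ConflictFree c = ∀ y → y ≢ root → ∃ λ col → IsCFColor c y col

  Inner : Fin n → Set
  Inner x = ∃ λ y → IsSon x y

  SVertex : (Fin n → Color) → Fin n → Set
  SVertex c x = Inner x × (∀ y → IsSon x y → c y ≡ blue)

  DVertex : (Fin n → Color) → Fin n → Set
  DVertex c x = Inner x × (∃ λ y → IsSon x y × c y ≡ red)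

  Ancestor : ℕ → Fin n → Fin n → Set
  Ancestor zero x y = x ≡ y
  Ancestor (suc k) x y = ∃ λ z → father y ≡ just z × Ancestor k x z

  -- Level v i y : y is a vertex of Sub_F(v) at level i (distance from v⁺)
  Level : Fin n → ℕ → Fin n → Set
  Level v zero y = father v ≡ just y
  Level v (suc k) y = Ancestor k v y

  FullSub : Fin n → ℕ → Set
  FullSub v m =
    1 ≤ m ×
    (∀ i y → 1 ≤ i → Level v i y → sonCount y ≡ 0 → i ≡ m) ×
    (∀ i y → 1 ≤ i → i < m → Level v i y → 2 ≤ sonCount y)

-- Call m − i the height of level i.  A vertex of height 1 has a leaf son, and
-- the red edge near the edge to that leaf is incident with the vertex.  If the
-- vertex has a sibling, which also has such a red edge, the only consistent
-- choice is a red son and a blue edge to the father.  So the edges to vertices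
-- of height 2 are blue too, which leaves the father edge as the red edge for
-- the edge from a height-3 vertex to its son: edges to vertices of height 3 are
-- red.  Two sibling edges are never both red, so no vertex has height 4, i.e.
-- m ≤ 4.  Hence the levels of heights 1, 2, 3 consist of D-, S- and S-vertices,
-- except that a height-1 level 1 is the single vertex v and is uniform anyway.
module Submission where

open import Defs
open import Data.Nat using (ℕ; _≤_; _<_; _∸_; zero; suc; _+_; z≤n; s≤s; z<s)
open import Data.Nat.Properties
  using ( +-comm; +-suc; +-cancelʳ-≡; m≢1+n+m; m≤n⇒∃[o]m+o≡n; m<n+m; <⇒≤
        ; <-irrefl; ≤-refl; ≤-trans; n≤1+n; n<1+n; n≢0⇒n>0)
  renaming (_≟_ to _≟ℕ_)
open import Data.Fin using (Fin; toℕ)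
open import Data.Fin.Properties using (any?; pigeonhole) renaming (_≟_ to _≟ᶠ_)
open import Data.Maybe using (just)
open import Data.Maybe.Properties using (≡-dec; just-injective)
open import Data.List using (List; []; _∷_; length; filter; allFin)
open import Data.List.Relation.Unary.Any using (here; there)
open import Data.List.Relation.Unary.All using (_∷_)
open import Data.List.Relation.Unary.AllPairs using (_∷_)
open import Data.List.Relation.Unary.Unique.Propositional.Properties using (allFin⁺; filter⁺)
open import Data.List.Relation.Unary.Unique.Propositional using (Unique)
open import Data.List.Membership.Propositional using (_∈_)
open import Data.List.Membership.Propositional.Properties using (∈-filter⁻)
open import Data.Product using (∃; _×_; _,_; proj₁; proj₂)
open import Data.Sum using (_⊎_; inj₁; inj₂)
open import Data.Empty using (⊥-elim)
open import Relation.Nullary using (¬_; Dec; yes; no)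
open import Relation.Nullary.Decidable using (_×-dec_)
open import Relation.Binary.PropositionalEquality
  using (_≡_; _≢_; refl; sym; trans; cong; subst)

red? : (col : Color) → Dec (col ≡ red)
red? red  = yes refl
red? blue = no λ ()

non-red⇒blue : ∀ {col} → col ≢ red → col ≡ blue
non-red⇒blue {red}  col≢red = ⊥-elim (col≢red refl)
non-red⇒blue {blue} _       = refl

red≢blue : red ≢ blue
red≢blue ()

1+n+m≡o⇒m<o : ∀ n {m o} → suc n + m ≡ o → m < o
1+n+m≡o⇒m<o n {m} refl = m<n+m m {suc n} z<s

height-of-level : ∀ {i} m → 1 ≤ i → i ≤ m ∸ 1 → ∃ λ h → suc h + i ≡ m
height-of-level {i} (suc m) _ i≤m =
  let h , i+h≡m = m≤n⇒∃[o]m+o≡n i≤m in h , cong suc (trans (+-comm h i) i+h≡m)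
height-of-level {suc _} zero _ ()

module _ {n : ℕ} where

  length≥1⇒∈ : ∀ {xs : List (Fin n)} → 1 ≤ length xs → ∃ (_∈ xs)
  length≥1⇒∈ {x ∷ _} _ = x , here refl

  unique∧length≥2⇒∈≢ : ∀ {xs : List (Fin n)} → Unique xs → 2 ≤ length xs →
                        ∀ y → ∃ λ z → z ∈ xs × z ≢ y
  unique∧length≥2⇒∈≢ {_ ∷ []} _ (s≤s ())
  unique∧length≥2⇒∈≢ {a ∷ b ∷ _} ((a≢b ∷ _) ∷ _) _ y with a ≟ᶠ y
  ... | no a≢y   = a , here refl , a≢y
  ... | yes refl = b , there (here refl) , λ b≡a → a≢b (sym b≡a)

module _ {n : ℕ} (F : RootedTree n) where
  open RootedTree F

  private variable
    p q x y z : Fin n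

  Leaf : Fin n → Set
  Leaf x = ∀ y → ¬ IsSon F x y

  son? : ∀ x y → Dec (IsSon F x y)
  son? x y = ≡-dec _≟ᶠ_ (father y) (just x)

  son⇒nonroot : IsSon F p y → y ≢ root
  son⇒nonroot py refl with trans (sym py) root-nofather
  ... | ()

  father-unique : IsSon F p y → IsSon F q y → p ≡ q
  father-unique py qy = just-injective (trans (sym py) qy)

  son-irrefl : ¬ IsSon F x x
  son-irrefl {x} xx = m≢1+n+m (depth x) {0} (depth-father x x xx)

  son-asym : IsSon F x y → ¬ IsSon F y x
  son-asym {x} {y} xy yx =
    m≢1+n+m (depth y) {1} (trans (depth-father y x xy) (cong suc (depth-father x y yx)))

  sibling∈nbhd : IsSon F p y → IsSon F p z → EdgeNbhd F y z
  sibling∈nbhd {p} py pz = inj₁ (p , py , inj₁ pz)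

  father∈nbhd : IsSon F p y → p ≢ root → EdgeNbhd F y p
  father∈nbhd {p} py p≢r = inj₁ (p , py , inj₂ (refl , p≢r))

  son∈nbhd : IsSon F y z → EdgeNbhd F y z
  son∈nbhd yz = inj₂ (inj₁ yz)

  nbhd-cases : IsSon F p y → EdgeNbhd F y z → IsSon F p z ⊎ z ≡ p ⊎ IsSon F y z
  nbhd-cases py (inj₁ (q , qy , inj₁ qz))         = inj₁ (subst (λ r → IsSon F r _) (father-unique qy py) qz)
  nbhd-cases py (inj₁ (q , qy , inj₂ (refl , _))) = inj₂ (inj₁ (father-unique qy py))
  nbhd-cases py (inj₂ (inj₁ yz))                  = inj₂ (inj₂ yz)
  nbhd-cases py (inj₂ (inj₂ (refl , _)))          = inj₁ py

  ∈sons⇒son : y ∈ filter (son? x) (allFin n) → IsSon F x y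
  ∈sons⇒son {x = x} y∈ = proj₂ (∈-filter⁻ (son? x) {xs = allFin n} y∈)

  sonCount≥1⇒son : 1 ≤ sonCount F x → ∃ (IsSon F x)
  sonCount≥1⇒son {x} one with length≥1⇒∈ {xs = filter (son? x) (allFin n)} one
  ... | y , y∈ = y , ∈sons⇒son y∈

  sonCount≥2⇒son≢ : 2 ≤ sonCount F x → ∀ y → ∃ λ z → IsSon F x z × z ≢ y
  sonCount≥2⇒son≢ {x} two y
    with unique∧length≥2⇒∈≢ (filter⁺ (son? x) {xs = allFin n} (allFin⁺ n)) two y
  ... | z , z∈ , z≢y = z , ∈sons⇒son z∈ , z≢y

  no-infinite-descent : (P : Fin n → Set) → (∀ {x} → P x → ∃ λ y → IsSon F x y × P y) →
                        ∀ {x} → ¬ P x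
  -- The depths along a descending path are pairwise distinct, yet n + 1 of its
  -- vertices lie in Fin n.
  no-infinite-descent P step {x} px =
    let _ , _ , i<j , same = pigeonhole (n<1+n n) (λ t → proj₁ (path (toℕ t)))
    in <-irrefl (path-injective _ _ same) i<j
    where
    path : ℕ → ∃ P
    path zero    = x , px
    path (suc t) = let y , _ , py = step (proj₂ (path t)) in y , py

    path-depth : ∀ t → depth (proj₁ (path t)) ≡ t + depth x
    path-depth zero    = refl
    path-depth (suc t) = trans (depth-father _ _ (proj₁ (proj₂ (step (proj₂ (path t))))))
                               (cong suc (path-depth t))

    path-injective : ∀ s t → proj₁ (path s) ≡ proj₁ (path t) → s ≡ t
    path-injective s t same = +-cancelʳ-≡ (depth x) s t
      (trans (sym (path-depth s)) (trans (cong depth same) (path-depth t)))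

  inner⇒S⊎D : (c : Fin n → Color) → Inner F x → SVertex F c x ⊎ DVertex F c x
  inner⇒S⊎D {x} c inner with any? (λ y → son? x y ×-dec red? (c y))
  ... | yes (y , xy , red-y) = inj₂ (inner , y , xy , red-y)
  ... | no no-red-son       =
    inj₁ (inner , λ y xy → non-red⇒blue λ red-y → no-red-son (y , xy , red-y))

module RedConflictFree {n : ℕ} (F : RootedTree n) (c : Fin n → Color)
  (red-cf : ∀ y → y ≢ RootedTree.root F → IsCFColor F c y red) where

  private variable
    p x x′ y z s : Fin n

  RedSon : Fin n → Set
  RedSon x = ∃ λ s → IsSon F x s × c s ≡ red

  red-unique : IsSon F p y → ∀ {a b} →
               EdgeNbhd F y a → c a ≡ red → EdgeNbhd F y b → c b ≡ red → a ≡ b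
  red-unique py a∈ red-a b∈ red-b with red-cf _ (son⇒nonroot F py)
  ... | _ , _ , _ , unique = trans (unique _ a∈ red-a) (sym (unique _ b∈ red-b))

  red-siblings-equal : IsSon F p x → IsSon F p x′ → c x ≡ red → c x′ ≡ red → x ≡ x′
  red-siblings-equal px px′ red-x red-x′ =
    red-unique px (sibling∈nbhd F px px) red-x (sibling∈nbhd F px px′) red-x′

  red-son⇒siblings-blue : IsSon F p x → IsSon F x s → c s ≡ red → IsSon F p z → c z ≡ blue
  -- z ≡ s would make s a son of both p and x, so that p ≡ x is its own son.
  red-son⇒siblings-blue px xs red-s pz = non-red⇒blue λ red-z →
    let z≡s = red-unique px (sibling∈nbhd F px pz) red-z (son∈nbhd F xs) red-s
    in son-irrefl F (subst (λ w → IsSon F w _) (father-unique F (subst (IsSon F _) z≡s pz) xs) px)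

  red-son⇒father-blue : IsSon F p x → p ≢ RootedTree.root F →
                        IsSon F x s → c s ≡ red → c p ≡ blue
  red-son⇒father-blue px p≢r xs red-s = non-red⇒blue λ red-p →
    let p≡s = red-unique px (father∈nbhd F px p≢r) red-p (son∈nbhd F xs) red-s
    in son-asym F px (subst (IsSon F _) (sym p≡s) xs)

  leaf-father⇒red⊎red-son : IsSon F y x → Leaf F x → c y ≡ red ⊎ RedSon y
  leaf-father⇒red⊎red-son yx leaf with red-cf _ (son⇒nonroot F yx)
  ... | s , s∈ , red-s , _ with nbhd-cases F yx s∈
  ...   | inj₁ ys          = inj₂ (s , ys , red-s)
  ...   | inj₂ (inj₁ refl) = inj₁ red-s
  ...   | inj₂ (inj₂ xs)   = ⊥-elim (leaf s xs)

  sibling⇒red-son : IsSon F p x → IsSon F p x′ → x′ ≢ x →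
                    c x ≡ red ⊎ RedSon x → c x′ ≡ red ⊎ RedSon x′ → RedSon x
  sibling⇒red-son _  _   _     (inj₂ red-son) _ = red-son
  sibling⇒red-son px px′ x′≢x (inj₁ red-x) (inj₁ red-x′) =
    ⊥-elim (x′≢x (red-siblings-equal px′ px red-x′ red-x))
  sibling⇒red-son px px′ x′≢x (inj₁ red-x) (inj₂ (s , x′s , red-s)) =
    ⊥-elim (red≢blue (trans (sym red-x) (red-son⇒siblings-blue px′ x′s red-s px)))

  blue-around⇒father-red : IsSon F y z → (∀ z′ → IsSon F y z′ → c z′ ≡ blue) →
                           (∀ s → IsSon F z s → c s ≡ blue) → c y ≡ red
  blue-around⇒father-red yz sons-blue grandsons-blue with red-cf _ (son⇒nonroot F yz)
  ... | r , r∈ , red-r , _ with nbhd-cases F yz r∈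
  ...   | inj₁ yr          = ⊥-elim (red≢blue (trans (sym red-r) (sons-blue r yr)))
  ...   | inj₂ (inj₁ refl) = red-r
  ...   | inj₂ (inj₂ zr)   = ⊥-elim (red≢blue (trans (sym red-r) (grandsons-blue r zr)))

module FullSubtree {n : ℕ} (F : RootedTree n) {v : Fin n} {m : ℕ}
  (v≢r : v ≢ RootedTree.root F) (full : FullSub F v m) where
  open RootedTree F

  private variable
    k : ℕ
    x y : Fin n

  level-son : Level F v (suc k) x → IsSon F x y → Level F v (suc (suc k)) y
  level-son {x = x} lx xy = x , xy , lx

  level-nonroot : Level F v (suc k) y → y ≢ root
  level-nonroot {zero}  refl        = v≢r
  level-nonroot {suc k} (_ , py , _) = son⇒nonroot F py

  level-branching : Level F v (suc k) y → suc k < m → 2 ≤ sonCount F y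
  level-branching ly k<m = proj₂ (proj₂ full) _ _ (s≤s z≤n) k<m ly

  level-son≢ : Level F v (suc k) y → suc k < m → ∀ x → ∃ λ z → IsSon F y z × z ≢ x
  level-son≢ ly k<m = sonCount≥2⇒son≢ F (level-branching ly k<m)

  level-son∃ : Level F v (suc k) y → suc k < m → ∃ (IsSon F y)
  level-son∃ ly k<m = sonCount≥1⇒son F (≤-trans (s≤s z≤n) (level-branching ly k<m))

  level-inhabited : suc k ≤ m → ∃ (Level F v (suc k))
  level-inhabited {zero}  _  = v , refl
  level-inhabited {suc k} k<m with level-inhabited {k} (≤-trans (n≤1+n _) k<m)
  ... | y , ly = let z , yz = level-son∃ ly k<m in z , level-son ly yz

  below-bottom-empty : ∀ {j} → m < j → ¬ Level F v j y
  below-bottom-empty {j = j} m<j lj = no-infinite-descent F Deep descend (j , m<j , lj)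
    where
    Deep : Fin n → Set
    Deep y = ∃ λ j → m < j × Level F v j y

    descend : ∀ {y} → Deep y → ∃ λ z → IsSon F y z × Deep z
    descend {y} (suc j , m<j , lj) with sonCount F y ≟ℕ 0
    ... | yes leaf = ⊥-elim (<-irrefl (sym (proj₁ (proj₂ full) _ _ (s≤s z≤n) lj leaf)) m<j)
    ... | no inner =
      let z , yz = sonCount≥1⇒son F (n≢0⇒n>0 inner)
      in z , yz , suc (suc j) , ≤-trans m<j (n≤1+n _) , level-son lj yz

  bottom-leaf : Level F v (suc k) y → suc k ≡ m → Leaf F y
  bottom-leaf ly refl z yz = below-bottom-empty ≤-refl (level-son ly yz)

module Heights {n : ℕ} (F : RootedTree n) (c : Fin n → Color)
  (red-cf : ∀ y → y ≢ RootedTree.root F → IsCFColor F c y red)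
  {v : Fin n} {m : ℕ} (v≢r : v ≢ RootedTree.root F) (full : FullSub F v m) where
  open FullSubtree F v≢r full
  open RedConflictFree F c red-cf

  private variable
    k : ℕ
    x y : Fin n

  -- Height h of level suc k is stated as h + suc k ≡ m with a numeral h, so the
  -- same equation also states height h − 1 of the level below.
  height1-red⊎red-son : Level F v (suc k) x → 1 + suc k ≡ m → c x ≡ red ⊎ RedSon x
  height1-red⊎red-son lx h1 =
    let ℓ , xℓ = level-son∃ lx (1+n+m≡o⇒m<o 0 h1)
    in leaf-father⇒red⊎red-son xℓ (bottom-leaf (level-son lx xℓ) h1)

  height1-red-son : Level F v (2 + k) x → 3 + k ≡ m → RedSon x
  height1-red-son {x = x} lx@(p , px , lp) h1 =
    let x′ , px′ , x′≢x = level-son≢ lp (1+n+m≡o⇒m<o 1 h1) x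
    in sibling⇒red-son px px′ x′≢x (height1-red⊎red-son lx h1)
                                    (height1-red⊎red-son (level-son lp px′) h1)

  height1-blue : Level F v (2 + k) x → 3 + k ≡ m → c x ≡ blue
  height1-blue lx@(_ , px , _) h1 =
    let _ , xs , red-s = height1-red-son lx h1 in red-son⇒siblings-blue px xs red-s px

  height2-blue : Level F v (suc k) y → 2 + suc k ≡ m → c y ≡ blue
  height2-blue ly h2 =
    let w , yw = level-son∃ ly (1+n+m≡o⇒m<o 1 h2)
        _ , ws , red-s = height1-red-son (level-son ly yw) h2
    in red-son⇒father-blue yw (level-nonroot ly) ws red-s

  height3-red : Level F v (suc k) y → 3 + suc k ≡ m → c y ≡ red
  height3-red ly h3 =
    let z , yz = level-son∃ ly (1+n+m≡o⇒m<o 2 h3)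
    in blue-around⇒father-red yz (λ _ yz′ → height2-blue (level-son ly yz′) h3)
                                 (λ _ zs → height1-blue (level-son (level-son ly yz) zs) h3)

  height4-empty : Level F v (suc k) x → 4 + suc k ≢ m
  height4-empty lx h4 =
    let y  , xy      = level-son∃ lx (1+n+m≡o⇒m<o 3 h4)
        y′ , xy′ , y′≢y = level-son≢ lx (1+n+m≡o⇒m<o 3 h4) y
    in y′≢y (red-siblings-equal xy′ xy (height3-red (level-son lx xy′) h4)
                                       (height3-red (level-son lx xy) h4))

  height≥4-empty : ∀ d k → 4 + d + suc k ≢ m
  height≥4-empty d k h =
    let h′ = trans (cong (4 +_) (sym (+-suc d k))) h
        _ , lx = level-inhabited (<⇒≤ (1+n+m≡o⇒m<o 3 h′))
    in height4-empty lx h′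

lemma2 : ∀ {n} (F : RootedTree n) (c : Fin n → Color) →
         (∀ x → degree F x ≢ 2) →
         degree F (RootedTree.root F) ≡ 1 →
         ConflictFree F c →
         (∀ y → y ≢ RootedTree.root F → IsCFColor F c y red) →
         ∀ (v : Fin n) (m : ℕ) → v ≢ RootedTree.root F →
         FullSub F v m →
         ∀ (i : ℕ) → 1 ≤ i → i ≤ m ∸ 1 →
         (∀ y → Level F v i y → SVertex F c y) ⊎
         (∀ y → Level F v i y → DVertex F c y)
lemma2 F c _ _ _ red-cf v m v≢r full (suc j) 1≤i i≤m∸1 =
  by-height j (height-of-level m 1≤i i≤m∸1)
  where
  open FullSubtree F v≢r full
  open Heights F c red-cf v≢r full
  open RedConflictFree F c red-cf using (RedSon)

  S-if-sons-blue : ∀ {k y} → Level F v (suc k) y → suc k < m →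
                   (∀ s → IsSon F y s → c s ≡ blue) → SVertex F c y
  S-if-sons-blue ly k<m sons-blue = level-son∃ ly k<m , sons-blue

  D-if-red-son : ∀ {y} → RedSon y → DVertex F c y
  D-if-red-son (s , ys , red-s) = (s , ys) , (s , ys , red-s)

  by-height : ∀ k → (∃ λ h → suc h + suc k ≡ m) →
              (∀ y → Level F v (suc k) y → SVertex F c y) ⊎
              (∀ y → Level F v (suc k) y → DVertex F c y)
  by-height zero (0 , h1) with inner⇒S⊎D F c (level-son∃ refl (1+n+m≡o⇒m<o 0 h1))
  ... | inj₁ S = inj₁ λ { _ refl → S }
  ... | inj₂ D = inj₂ λ { _ refl → D }
  by-height (suc k) (0 , h1) = inj₂ λ _ ly → D-if-red-son (height1-red-son ly h1)
  by-height k (1 , h2) = inj₁ λ _ ly →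
    S-if-sons-blue ly (1+n+m≡o⇒m<o 1 h2) λ _ ys → height1-blue (level-son ly ys) h2
  by-height k (2 , h3) = inj₁ λ _ ly →
    S-if-sons-blue ly (1+n+m≡o⇒m<o 2 h3) λ _ ys → height2-blue (level-son ly ys) h3
  by-height k (suc (suc (suc d)) , h) = ⊥-elim (height≥4-empty d k h)
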